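{- Let $k\geq 1$ be an integer. Every finite triangle-free simple graph $G$ with at least one vertex and average degree at least $2k$ (i.e. $2e(G)/v(G)\geq 2k$) has a $(k+1)$-connected subgraph, and such a subgraph has at least $2(k+1)$ vertices.
   Context: $v(G)$ and $e(G)$ denote the numbers of vertices and edges of $G$. A graph is $(k+1)$-connected if it has more than $k+1$ vertices and remains connected after deleting any set of at most $k$ vertices. -}

module Defs where

open import Data.Nat using (ℕ; zero; suc; _+_; _*_; _≤_; _<_; _<ᵇ_)
open import Data.Bool using (Bool; true; false; _∧_; if_then_else_)
open import Data.Fin using (Fin; toℕ)
open import Data.List using (List; map; allFin)
open import Data.Nat.ListAction using (sum)
open import Data.Product using (_×_)
open import Data.Empty using (⊥)
open import Relation.Binary.PropositionalEquality using (_≡_)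

count : {n : ℕ} → (Fin n → Bool) → ℕ
count {n} p = sum (map (λ i → if p i then 1 else 0) (allFin n))

record Graph (n : ℕ) : Set where
  field
    adj    : Fin n → Fin n → Bool
    sym    : ∀ i j → adj i j ≡ adj j i
    irrefl : ∀ i → adj i i ≡ false
open Graph public

v : {n : ℕ} → Graph n → ℕ
v {n} _ = n

e : {n : ℕ} → Graph n → ℕ
e {n} G = sum (map (λ i → count (λ j → (toℕ i <ᵇ toℕ j) ∧ adj G i j)) (allFin n))

TriangleFree : {n : ℕ} → Graph n → Set
TriangleFree {n} G = ∀ (i j l : Fin n) →
  adj G i j ≡ true → adj G j l ≡ true → adj G i l ≡ true → ⊥

record Subgraph {n : ℕ} (G : Graph n) : Set where
  field
    vs     : Fin n → Bool
    es     : Fin n → Fin n → Bool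
    es-sym : ∀ i j → es i j ≡ es j i
    es-sub : ∀ i j → es i j ≡ true → adj G i j ≡ true
    es-vs  : ∀ i j → es i j ≡ true → vs i ≡ true × vs j ≡ true
open Subgraph public

vH : {n : ℕ} {G : Graph n} → Subgraph G → ℕ
vH H = count (vs H)

-- walks in H - X  (all vertices visited after the start lie outside X;
-- the start vertex is required to be outside X by the users of Reach)
data Reach {n : ℕ} {G : Graph n} (H : Subgraph G) (X : Fin n → Bool) :
    Fin n → Fin n → Set where
  here : ∀ {u} → Reach H X u u
  step : ∀ {u w t} → es H u w ≡ true → X w ≡ false → Reach H X w t → Reach H X u t

ConnectedMinus : {n : ℕ} {G : Graph n} → Subgraph G → (Fin n → Bool) → Set
ConnectedMinus {n} H X = ∀ (u w : Fin n) →
  vs H u ≡ true → X u ≡ false → vs H w ≡ true → X w ≡ false → Reach H X u w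

IsConnected : {n : ℕ} {G : Graph n} → ℕ → Subgraph G → Set
IsConnected {n} c H =
  c < vH H ×
  (∀ (X : Fin n → Bool) → (∀ i → X i ≡ true → vs H i ≡ true) →
     suc (count X) ≤ c → ConnectedMinus H X)

-- Call a vertex set S dense if |S| ≥ 2k + 2 and e(G[S]) > k(|S| − k). The whole vertex set is
-- dense: e(G) ≥ kn, and Mantel's bound e(G) ≤ n²/4 then forces n ≥ 4k. Take a dense S of minimum
-- size. Deleting a vertex of degree ≤ k preserves e(G[S]) > k(|S| − k), and by Mantel no set of
-- 2k + 1 vertices satisfies it, so G[S] has minimum degree ≥ k + 1. Suppose |X| ≤ k and G[S] − X
-- is disconnected, and let R be the part reachable from one vertex. Both R ∪ X and S ∖ R are
-- smaller than S and contain, with a vertex a outside X, a neighbour b of a outside X and all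
-- neighbours of a and b in S; these neighbourhoods are disjoint as G is triangle-free, so both
-- sets have at least 2k + 2 vertices and hence violate the edge bound. As every edge of G[S] lies
-- in one of them and their sizes add up to at most |S| + k, the two violations contradict
-- e(G[S]) > k(|S| − k). The disjoint neighbourhoods of the ends of an edge also give the bound
-- 2(k + 1) for any (k + 1)-connected triangle-free graph.

module Submission where

open import Defs renaming (sym to adj-sym)
import Algebra.Properties.CommutativeMonoid.Sum as CommutativeMonoidSum
open import Data.Bool using (Bool; true; false; _∧_; _∨_; not; if_then_else_; T)
open import Data.Bool.Properties using (∧-identityʳ; ∧-zeroʳ; ∧-conicalˡ; ∧-conicalʳ; not-injective; ∨-zeroʳ; ∨-conicalˡ; ∨-conicalʳ)
import Data.Bool.Properties as Bool
open import Data.Empty using (⊥; ⊥-elim)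
open import Data.Fin using (Fin; zero; suc; _≟_; toℕ)
open import Data.Fin.Properties using (any?)
open import Data.Fin.Subset.Properties using (anySubset?)
open import Data.List using (tabulate)
open import Data.List.Properties using (map-tabulate)
open import Data.Nat using (ℕ; zero; suc; _+_; _*_; _≤_; _<_; _<ᵇ_; z≤n; s≤s; >-nonZero)
open import Data.Nat.Induction using (<-wellFounded)
import Data.Nat.ListAction as List
open import Data.Nat.Properties hiding (_≟_)
open import Data.Nat.Tactic.RingSolver using (solve-∀)
open import Data.Product using (Σ; ∃; _×_; _,_; proj₁; proj₂)
open import Data.Sum using (_⊎_; inj₁; inj₂)
open import Data.Vec using (lookup) renaming (tabulate to vtabulate)
open import Data.Vec.Properties using (lookup∘tabulate)
open import Function using (id; _∘_)
import Induction.WellFounded as WF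
import Relation.Binary.Construct.On as On
open import Relation.Binary.PropositionalEquality
open import Relation.Nullary using (¬_; Dec; yes; no; does)
open import Relation.Nullary.Decidable using (_×-dec_)

open CommutativeMonoidSum +-0-commutativeMonoid
  using (sum; sum-syntax; ∑-distrib-+; ∑-comm; sum-cong-≗; sum-replicate-zero)

false≢true : false ≡ true → ⊥
false≢true ()

VertexSet : ℕ → Set
VertexSet n = Fin n → Bool

ind : Bool → ℕ
ind b = if b then 1 else 0

ind-∧ʳ : ∀ x y → ind (x ∧ y) ≤ ind y
ind-∧ʳ true  y = ≤-refl
ind-∧ʳ false y = z≤n

ind-cover₃ : ∀ {x y z w} → (x ≡ true → y ≡ true ⊎ z ≡ true ⊎ w ≡ true) → ind x ≤ ind y + (ind z + ind w)
ind-cover₃ {false} _ = z≤n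
ind-cover₃ {true} {y} {z} {w} cover with cover refl
... | inj₁ refl        = s≤s z≤n
... | inj₂ (inj₁ refl) = ≤-trans (s≤s z≤n) (m≤n+m (1 + ind w) (ind y))
... | inj₂ (inj₂ refl) = ≤-trans (m≤n+m 1 (ind z)) (m≤n+m _ (ind y))

ind-cover : ∀ {x y z} → (x ≡ true → y ≡ true ⊎ z ≡ true) → ind x ≤ ind y + ind z
ind-cover {false} _ = z≤n
ind-cover {true} {y} {z} cover with cover refl
... | inj₁ refl = s≤s z≤n
... | inj₂ refl = m≤n+m 1 (ind y)

∑-mono-≤ : ∀ {n} {f g : Fin n → ℕ} → (∀ i → f i ≤ g i) → sum f ≤ sum g
∑-mono-≤ {zero}  f≤g = z≤n
∑-mono-≤ {suc n} f≤g = +-mono-≤ (f≤g zero) (∑-mono-≤ (f≤g ∘ suc))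

sum-tabulate : ∀ {n} (f : Fin n → ℕ) → List.sum (tabulate f) ≡ sum f
sum-tabulate {zero}  f = refl
sum-tabulate {suc n} f = cong (f zero +_) (sum-tabulate (f ∘ suc))

∑-⁅⁆ : ∀ {n} (a : Fin n) (f : Fin n → ℕ) → ∑[ i < n ] (if does (i ≟ a) then f i else 0) ≡ f a
∑-⁅⁆ {suc n} zero    f = trans (cong (f zero +_) (sum-replicate-zero n)) (+-identityʳ (f zero))
∑-⁅⁆ {suc n} (suc a) f = ∑-⁅⁆ a (f ∘ suc)

∑∑-distrib-+ : ∀ {n} (f g : Fin n → Fin n → ℕ) →
  ∑[ i < n ] ∑[ j < n ] (f i j + g i j) ≡ ∑[ i < n ] ∑[ j < n ] f i j + ∑[ i < n ] ∑[ j < n ] g i j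
∑∑-distrib-+ {n} f g = trans (sum-cong-≗ (λ i → ∑-distrib-+ (f i) (g i)))
  (∑-distrib-+ (λ i → ∑[ j < n ] f i j) (λ i → ∑[ j < n ] g i j))

∑∑-mono-≤ : ∀ {n} {f g : Fin n → Fin n → ℕ} → (∀ i j → f i j ≤ g i j) →
  ∑[ i < n ] ∑[ j < n ] f i j ≤ ∑[ i < n ] ∑[ j < n ] g i j
∑∑-mono-≤ f≤g = ∑-mono-≤ (λ i → ∑-mono-≤ (f≤g i))

module _ {n : ℕ} where

  infixr 7 _∩_
  infixr 6 _∪_ _∖_
  infix 4 _⊆_

  full : VertexSet n
  full _ = true

  ⁅_⁆ : Fin n → VertexSet n
  ⁅ a ⁆ i = does (i ≟ a)

  _∩_ _∪_ _∖_ : VertexSet n → VertexSet n → VertexSet n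
  (p ∩ q) i = p i ∧ q i
  (p ∪ q) i = p i ∨ q i
  (p ∖ q) i = p i ∧ not (q i)

  _⊆_ : VertexSet n → VertexSet n → Set
  p ⊆ q = ∀ i → p i ≡ true → q i ≡ true

  ⁅⁆-self : (a : Fin n) → ⁅ a ⁆ a ≡ true
  ⁅⁆-self a with a ≟ a
  ... | yes _   = refl
  ... | no  a≢a = ⊥-elim (a≢a refl)

  count≡∑ : (p : VertexSet n) → count p ≡ ∑[ i < n ] ind (p i)
  count≡∑ p = trans (cong List.sum (map-tabulate id (ind ∘ p))) (sum-tabulate (ind ∘ p))

  count-cong : {p q : VertexSet n} → (∀ i → p i ≡ q i) → count p ≡ count q
  count-cong {p} {q} p≗q = begin
    count p               ≡⟨ count≡∑ p ⟩
    ∑[ i < n ] ind (p i)  ≡⟨ sum-cong-≗ (cong ind ∘ p≗q) ⟩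
    ∑[ i < n ] ind (q i)  ≡⟨ count≡∑ q ⟨
    count q               ∎
    where open ≡-Reasoning

  count-mono : {p q : VertexSet n} → p ⊆ q → count p ≤ count q
  count-mono {p} {q} p⊆q = begin
    count p               ≡⟨ count≡∑ p ⟩
    ∑[ i < n ] ind (p i)  ≤⟨ ∑-mono-≤ ind-mono ⟩
    ∑[ i < n ] ind (q i)  ≡⟨ count≡∑ q ⟨
    count q               ∎
    where
    open ≤-Reasoning
    ind-mono : ∀ i → ind (p i) ≤ ind (q i)
    ind-mono i with p i in pᵢ
    ... | false = z≤n
    ... | true rewrite p⊆q i pᵢ = ≤-refl

  count-+ : (p q : VertexSet n) → count p + count q ≡ ∑[ i < n ] (ind (p i) + ind (q i))
  count-+ p q = trans (cong₂ _+_ (count≡∑ p) (count≡∑ q)) (sym (∑-distrib-+ (ind ∘ p) (ind ∘ q)))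

  count-∪-∩ : (p q : VertexSet n) → count (p ∪ q) + count (p ∩ q) ≡ count p + count q
  count-∪-∩ p q = trans (count-+ (p ∪ q) (p ∩ q)) (trans (sum-cong-≗ pointwise) (sym (count-+ p q)))
    where
    pointwise : ∀ i → ind (p i ∨ q i) + ind (p i ∧ q i) ≡ ind (p i) + ind (q i)
    pointwise i with p i | q i
    ... | true  | true  = refl
    ... | true  | false = refl
    ... | false | true  = refl
    ... | false | false = refl

  count-∖-∩ : (p q : VertexSet n) → count (p ∖ q) + count (p ∩ q) ≡ count p
  count-∖-∩ p q = trans (count-+ (p ∖ q) (p ∩ q)) (trans (sum-cong-≗ pointwise) (sym (count≡∑ p)))
    where
    pointwise : ∀ i → ind (p i ∧ not (q i)) + ind (p i ∧ q i) ≡ ind (p i)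
    pointwise i with p i | q i
    ... | true  | true  = refl
    ... | true  | false = refl
    ... | false | _     = refl

  count-empty : {p : VertexSet n} → (∀ i → p i ≡ false) → count p ≡ 0
  count-empty {p} p≗∅ = trans (count≡∑ p) (trans (sum-cong-≗ (cong ind ∘ p≗∅)) (sum-replicate-zero n))

  count-full : count full ≡ n
  count-full = trans (count≡∑ full) (go n)
    where
    go : ∀ m → ∑[ i < m ] 1 ≡ m
    go zero    = refl
    go (suc m) = cong suc (go m)

  count-⁅⁆ : (a : Fin n) → count ⁅ a ⁆ ≡ 1
  count-⁅⁆ a = trans (count≡∑ ⁅ a ⁆) (∑-⁅⁆ a (λ _ → 1))

  count≤n : (p : VertexSet n) → count p ≤ n
  count≤n p = subst (count p ≤_) count-full (count-mono (λ _ _ → refl))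

  count-disjoint : {p q r : VertexSet n} → (∀ i → p i ≡ true → q i ≡ true → ⊥) →
    p ⊆ r → q ⊆ r → count p + count q ≤ count r
  count-disjoint {p} {q} {r} disjoint p⊆r q⊆r = begin
    count p + count q            ≡⟨ count-∪-∩ p q ⟨
    count (p ∪ q) + count (p ∩ q) ≡⟨ cong (count (p ∪ q) +_) (count-empty p∩q≗∅) ⟩
    count (p ∪ q) + 0            ≡⟨ +-identityʳ _ ⟩
    count (p ∪ q)                ≤⟨ count-mono p∪q⊆r ⟩
    count r                      ∎
    where
    open ≤-Reasoning
    p∩q≗∅ : ∀ i → p i ∧ q i ≡ false
    p∩q≗∅ i with p i in pᵢ | q i in qᵢ
    ... | true  | true  = ⊥-elim (disjoint i pᵢ qᵢ)
    ... | true  | false = refl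
    ... | false | _     = refl
    p∪q⊆r : p ∪ q ⊆ r
    p∪q⊆r i _  with p i in pᵢ
    p∪q⊆r i _  | true = p⊆r i pᵢ
    p∪q⊆r i qᵢ | false = q⊆r i qᵢ

  count-∖⁅⁆ : (p : VertexSet n) (a : Fin n) → p a ≡ true → count p ≡ suc (count (p ∖ ⁅ a ⁆))
  count-∖⁅⁆ p a pₐ = begin
    count p                             ≡⟨ count-∖-∩ p ⁅ a ⁆ ⟨
    count (p ∖ ⁅ a ⁆) + count (p ∩ ⁅ a ⁆) ≡⟨ cong (count (p ∖ ⁅ a ⁆) +_) (count-cong p∩⁅a⁆≗⁅a⁆) ⟩
    count (p ∖ ⁅ a ⁆) + count ⁅ a ⁆       ≡⟨ cong (count (p ∖ ⁅ a ⁆) +_) (count-⁅⁆ a) ⟩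
    count (p ∖ ⁅ a ⁆) + 1                ≡⟨ +-comm _ 1 ⟩
    suc (count (p ∖ ⁅ a ⁆))              ∎
    where
    open ≡-Reasoning
    p∩⁅a⁆≗⁅a⁆ : ∀ i → p i ∧ ⁅ a ⁆ i ≡ ⁅ a ⁆ i
    p∩⁅a⁆≗⁅a⁆ i with i ≟ a
    ... | yes refl rewrite pₐ = refl
    ... | no  _    = ∧-zeroʳ (p i)

  count-⊂ : {p q : VertexSet n} {a : Fin n} → p ⊆ q → q a ≡ true → p a ≡ false → count p < count q
  count-⊂ {p} {q} {a} p⊆q qₐ pₐ = begin-strict
    count p               <⟨ n<1+n (count p) ⟩
    suc (count p)         ≡⟨ +-comm 1 (count p) ⟩
    count p + 1           ≡⟨ cong (count p +_) (count-⁅⁆ a) ⟨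
    count p + count ⁅ a ⁆  ≤⟨ count-disjoint a∉p p⊆q ⁅a⁆⊆q ⟩
    count q               ∎
    where
    open ≤-Reasoning
    a∉p : ∀ i → p i ≡ true → ⁅ a ⁆ i ≡ true → ⊥
    a∉p i pᵢ _ with i ≟ a
    a∉p i pᵢ _  | yes refl = false≢true (trans (sym pₐ) pᵢ)
    a∉p i pᵢ () | no _
    ⁅a⁆⊆q : ⁅ a ⁆ ⊆ q
    ⁅a⁆⊆q i _ with i ≟ a
    ⁅a⁆⊆q i _  | yes refl = qₐ
    ⁅a⁆⊆q i () | no _

  count-≤-∖ : (p q : VertexSet n) → count p ≤ count (p ∖ q) + count q
  count-≤-∖ p q = begin
    count p                     ≡⟨ count-∖-∩ p q ⟨
    count (p ∖ q) + count (p ∩ q) ≤⟨ +-monoʳ-≤ (count (p ∖ q)) (count-mono p∩q⊆q) ⟩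
    count (p ∖ q) + count q       ∎
    where
    open ≤-Reasoning
    p∩q⊆q : p ∩ q ⊆ q
    p∩q⊆q i pᵢ∧qᵢ with p i
    ... | true = pᵢ∧qᵢ

  count-∪-∖ : {R S X : VertexSet n} → R ⊆ S → (∀ i → R i ≡ true → X i ≡ true → ⊥) →
    count (R ∪ X) + count (S ∖ R) ≡ count S + count X
  count-∪-∖ {R = R} {S} {X} R⊆S disjoint = begin
    count (R ∪ X) + count (S ∖ R)              ≡⟨ cong (_+ count (S ∖ R)) R∪X≡R+X ⟩
    count R + count X + count (S ∖ R)          ≡⟨ regroup (count R) (count X) (count (S ∖ R)) ⟩
    (count (S ∖ R) + count R) + count X        ≡⟨ cong (λ r → count (S ∖ R) + r + count X) (count-cong S∩R≗R) ⟨
    (count (S ∖ R) + count (S ∩ R)) + count X  ≡⟨ cong (_+ count X) (count-∖-∩ S R) ⟩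
    count S + count X                          ∎
    where
    open ≡-Reasoning
    R∪X≡R+X : count (R ∪ X) ≡ count R + count X
    R∪X≡R+X = trans (sym (+-identityʳ _)) (trans (cong (count (R ∪ X) +_) (sym (count-empty R∩X≗∅))) (count-∪-∩ R X))
      where
      R∩X≗∅ : ∀ i → R i ∧ X i ≡ false
      R∩X≗∅ i with R i in Rᵢ | X i in Xᵢ
      ... | true  | true  = ⊥-elim (disjoint i Rᵢ Xᵢ)
      ... | true  | false = refl
      ... | false | _     = refl
    S∩R≗R : ∀ i → S i ∧ R i ≡ R i
    S∩R≗R i with R i in Rᵢ
    ... | true  rewrite R⊆S i Rᵢ = refl
    ... | false = ∧-zeroʳ (S i)
    regroup : ∀ r x d → r + x + d ≡ (d + r) + x
    regroup = solve-∀

  count-∪-≤ : (p q : VertexSet n) → count (p ∪ q) ≤ count p + count q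
  count-∪-≤ p q = ≤-trans (m≤m+n (count (p ∪ q)) (count (p ∩ q))) (≤-reflexive (count-∪-∩ p q))

  count>0⇒∃ : {p : VertexSet n} → 0 < count p → ∃ λ i → p i ≡ true
  count>0⇒∃ {p} 0<count with any? (λ i → p i Bool.≟ true)
  ... | yes found = found
  ... | no  none  = ⊥-elim (<-irrefl (sym (count-empty p≗∅)) 0<count)
    where
    p≗∅ : ∀ i → p i ≡ false
    p≗∅ i with p i in pᵢ
    ... | true  = ⊥-elim (none (i , pᵢ))
    ... | false = refl

  count<⇒∃∉ : {p r : VertexSet n} → count p < count r → ∃ λ i → r i ≡ true × p i ≡ false
  count<⇒∃∉ {p} {r} p<r with count>0⇒∃ {p = r ∖ p} (+-cancelʳ-< (count p) 0 _ (<-≤-trans p<r (count-≤-∖ r p)))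
  ... | i , rᵢ∧¬pᵢ = i , ∧-conicalˡ (r i) _ rᵢ∧¬pᵢ , not-injective (∧-conicalʳ (r i) _ rᵢ∧¬pᵢ)

  count-ind : ∀ {ℓ} (P : VertexSet n → Set ℓ) →
    (∀ S → (∀ T → count T < count S → P T) → P S) → ∀ S → P S
  count-ind P hyp = WF.All.wfRec (On.wellFounded count <-wellFounded) _ P (λ S rec → hyp S (λ _ → rec))

  smallest-witness : ∀ {ℓ} (P : VertexSet n → Set ℓ) → (∀ S → Dec (P S)) →
    (∀ {S T} → (∀ i → S i ≡ T i) → P S → P T) →
    ∀ {S} → P S → Σ (VertexSet n) λ S′ → P S′ × (∀ T → count T < count S′ → ¬ P T)
  smallest-witness P P? P-resp {S} = count-ind Goal descend S
    where
    Goal : VertexSet n → Set _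
    Goal S = P S → Σ (VertexSet n) λ S′ → P S′ × (∀ T → count T < count S′ → ¬ P T)
    descend : ∀ S → (∀ T → count T < count S → Goal T) → Goal S
    descend S rec PS with anySubset? (λ V → P? (lookup V) ×-dec (count (lookup V) <? count S))
    ... | yes (V , PV , V<S) = rec (lookup V) V<S PV
    ... | no  none           = S , PS , λ T T<S PT →
      none (vtabulate T , P-resp (sym ∘ lookup∘tabulate T) PT ,
            subst (_< count S) (sym (count-cong (lookup∘tabulate T))) T<S)

  ∑∑-⁅⁆ : (a : Fin n) (q : VertexSet n) → ∑[ i < n ] ∑[ j < n ] ind (⁅ a ⁆ i ∧ q j) ≡ count q
  ∑∑-⁅⁆ a q = begin
    ∑[ i < n ] ∑[ j < n ] ind (⁅ a ⁆ i ∧ q j)                       ≡⟨ sum-cong-≗ row ⟩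
    ∑[ i < n ] (if does (i ≟ a) then ∑[ j < n ] ind (q j) else 0)   ≡⟨ ∑-⁅⁆ a (λ _ → ∑[ j < n ] ind (q j)) ⟩
    ∑[ j < n ] ind (q j)                                            ≡⟨ count≡∑ q ⟨
    count q                                                         ∎
    where
    open ≡-Reasoning
    row : ∀ i → ∑[ j < n ] ind (⁅ a ⁆ i ∧ q j) ≡ (if does (i ≟ a) then ∑[ j < n ] ind (q j) else 0)
    row i with i ≟ a
    ... | yes _ = refl
    ... | no  _ = sum-replicate-zero n

module _ {n : ℕ} (G : Graph n) where

  deg : VertexSet n → Fin n → ℕ
  deg T a = count (T ∩ adj G a)

  arc : VertexSet n → Fin n → Fin n → Bool
  arc T i j = T i ∧ T j ∧ adj G i j

  arcs : VertexSet n → ℕ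
  arcs T = ∑[ i < n ] ∑[ j < n ] ind (arc T i j)

  arc-intro : {S : VertexSet n} {i j : Fin n} → S i ≡ true → S j ≡ true → adj G i j ≡ true → arc S i j ≡ true
  arc-intro Sᵢ Sⱼ Aᵢⱼ rewrite Sᵢ | Sⱼ = Aᵢⱼ

  arc-elim : {S : VertexSet n} {i j : Fin n} → arc S i j ≡ true → S i ≡ true × S j ≡ true × adj G i j ≡ true
  arc-elim {S} {i} {j} arcᵢⱼ =
    ∧-conicalˡ (S i) _ arcᵢⱼ , ∧-conicalˡ (S j) _ (∧-conicalʳ (S i) _ arcᵢⱼ) , ∧-conicalʳ (S j) _ (∧-conicalʳ (S i) _ arcᵢⱼ)

  arc-sym : (S : VertexSet n) (i j : Fin n) → arc S i j ≡ arc S j i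
  arc-sym S i j rewrite adj-sym G i j with S i | S j
  ... | true  | _     = refl
  ... | false | true  = refl
  ... | false | false = refl

  induced : VertexSet n → Subgraph G
  induced S = record
    { vs     = S
    ; es     = arc S
    ; es-sym = arc-sym S
    ; es-sub = λ _ _ arcᵢⱼ → proj₂ (proj₂ (arc-elim {S} arcᵢⱼ))
    ; es-vs  = λ _ _ arcᵢⱼ → proj₁ (arc-elim {S} arcᵢⱼ) , proj₁ (proj₂ (arc-elim {S} arcᵢⱼ))
    }

  arcs-cong : {S T : VertexSet n} → (∀ i → S i ≡ T i) → arcs S ≡ arcs T
  arcs-cong S≗T = sum-cong-≗ λ i → sum-cong-≗ λ j →
    cong₂ (λ x y → ind (x ∧ y ∧ adj G i j)) (S≗T i) (S≗T j)

  arcs≡0 : (T : VertexSet n) → (∀ i j → arc T i j ≡ true → ⊥) → arcs T ≡ 0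
  arcs≡0 T no-arc = trans (sum-cong-≗ λ i → trans (sum-cong-≗ (ind-false ∘ no-arc i)) (sum-replicate-zero n))
                            (sum-replicate-zero n)
    where
    ind-false : ∀ {x} → (x ≡ true → ⊥) → ind x ≡ 0
    ind-false {false} _ = refl
    ind-false {true}  x≢true = ⊥-elim (x≢true refl)

  arcs-cover : {T T₁ T₂ : VertexSet n} →
    (∀ i j → arc T i j ≡ true → arc T₁ i j ≡ true ⊎ arc T₂ i j ≡ true) →
    arcs T ≤ arcs T₁ + arcs T₂
  arcs-cover {T₁ = T₁} {T₂} cover = ≤-trans (∑∑-mono-≤ (λ i j → ind-cover (cover i j)))
    (≤-reflexive (∑∑-distrib-+ (λ i j → ind (arc T₁ i j)) (λ i j → ind (arc T₂ i j))))

  arcs-∖⁅⁆ : (T : VertexSet n) (a : Fin n) → arcs T ≤ arcs (T ∖ ⁅ a ⁆) + 2 * deg T a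
  arcs-∖⁅⁆ T a = begin
    arcs T
      ≤⟨ ∑∑-mono-≤ pointwise ⟩
    ∑[ i < n ] ∑[ j < n ] (ind (arc (T ∖ ⁅ a ⁆) i j) + (out i j + out j i))
      ≡⟨ ∑∑-distrib-+ (λ i j → ind (arc (T ∖ ⁅ a ⁆) i j)) (λ i j → out i j + out j i) ⟩
    arcs (T ∖ ⁅ a ⁆) + ∑[ i < n ] ∑[ j < n ] (out i j + out j i)
      ≡⟨ cong (arcs (T ∖ ⁅ a ⁆) +_) (∑∑-distrib-+ out (λ i j → out j i)) ⟩
    arcs (T ∖ ⁅ a ⁆) + (∑[ i < n ] ∑[ j < n ] out i j + ∑[ i < n ] ∑[ j < n ] out j i)
      ≡⟨ cong (λ x → arcs (T ∖ ⁅ a ⁆) + (∑[ i < n ] ∑[ j < n ] out i j + x)) (∑-comm (λ i j → out j i)) ⟩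
    arcs (T ∖ ⁅ a ⁆) + (∑[ i < n ] ∑[ j < n ] out i j + ∑[ j < n ] ∑[ i < n ] out j i)
      ≡⟨ cong (λ x → arcs (T ∖ ⁅ a ⁆) + (x + x)) (∑∑-⁅⁆ a (T ∩ adj G a)) ⟩
    arcs (T ∖ ⁅ a ⁆) + (deg T a + deg T a)
      ≡⟨ cong (λ x → arcs (T ∖ ⁅ a ⁆) + (deg T a + x)) (+-identityʳ (deg T a)) ⟨
    arcs (T ∖ ⁅ a ⁆) + 2 * deg T a
      ∎
    where
    open ≤-Reasoning
    out : Fin n → Fin n → ℕ
    out i j = ind (⁅ a ⁆ i ∧ (T ∩ adj G a) j)
    pointwise : ∀ i j → ind (arc T i j) ≤ ind (arc (T ∖ ⁅ a ⁆) i j) + (out i j + out j i)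
    pointwise i j = ind-cover₃ (split i j)
      where
      split : ∀ i j → arc T i j ≡ true →
        arc (T ∖ ⁅ a ⁆) i j ≡ true ⊎ (⁅ a ⁆ i ∧ (T ∩ adj G a) j) ≡ true ⊎ (⁅ a ⁆ j ∧ (T ∩ adj G a) i) ≡ true
      split i j arcᵢⱼ with i ≟ a | j ≟ a | ∧-conicalˡ (T i) _ arcᵢⱼ | ∧-conicalʳ (T i) _ arcᵢⱼ
      ... | yes refl | _        | _   | Tⱼ∧Aᵢⱼ = inj₂ (inj₁ Tⱼ∧Aᵢⱼ)
      ... | no _     | yes refl | Tᵢ  | Tⱼ∧Aᵢⱼ rewrite Tᵢ =
        inj₂ (inj₂ (trans (adj-sym G j i) (∧-conicalʳ (T j) _ Tⱼ∧Aᵢⱼ)))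
      ... | no _     | no _     | _   | _ rewrite ∧-identityʳ (T i) | ∧-identityʳ (T j) = inj₁ arcᵢⱼ

  deg-∖⁅⁆ : (T : VertexSet n) (a : Fin n) → deg (T ∖ ⁅ a ⁆) a ≡ deg T a
  deg-∖⁅⁆ T a = count-cong pointwise
    where
    pointwise : ∀ i → (T i ∧ not (⁅ a ⁆ i)) ∧ adj G a i ≡ T i ∧ adj G a i
    pointwise i with i ≟ a
    ... | yes refl rewrite irrefl G i = trans (∧-zeroʳ _) (sym (∧-zeroʳ _))
    ... | no  _    rewrite ∧-identityʳ (T i) = refl

  2e≤arcs : 2 * e G ≤ arcs full
  2e≤arcs = begin
    2 * e G                                                   ≡⟨ cong (λ x → x + (x + 0)) e≡∑∑below ⟩
    ∑∑ below + (∑∑ below + 0)                                 ≡⟨ cong (∑∑ below +_) (+-identityʳ _) ⟩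
    ∑∑ below + ∑∑ below                                       ≡⟨ cong (∑∑ below +_) ∑∑below≡∑∑above ⟩
    ∑∑ below + ∑∑ above                                       ≡⟨ ∑∑-distrib-+ below above ⟨
    ∑[ i < n ] ∑[ j < n ] (below i j + above i j)              ≤⟨ ∑∑-mono-≤ pointwise ⟩
    arcs full                                                 ∎
    where
    open ≤-Reasoning
    ∑∑ : (Fin n → Fin n → ℕ) → ℕ
    ∑∑ f = ∑[ i < n ] ∑[ j < n ] f i j
    below above : Fin n → Fin n → ℕ
    below i j = ind ((toℕ i <ᵇ toℕ j) ∧ adj G i j)
    above i j = ind ((toℕ j <ᵇ toℕ i) ∧ adj G i j)
    e≡∑∑below : e G ≡ ∑∑ below
    e≡∑∑below = trans (cong List.sum (map-tabulate id row)) (trans (sum-tabulate row) (sum-cong-≗ (count≡∑ ∘ later)))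
      where
      later : Fin n → VertexSet n
      later i j = (toℕ i <ᵇ toℕ j) ∧ adj G i j
      row : Fin n → ℕ
      row i = count (later i)
    ∑∑below≡∑∑above : ∑∑ below ≡ ∑∑ above
    ∑∑below≡∑∑above = trans (∑-comm below) (sum-cong-≗ λ i → sum-cong-≗ λ j →
      cong (λ b → ind ((toℕ j <ᵇ toℕ i) ∧ b)) (adj-sym G j i))
    pointwise : ∀ i j → below i j + above i j ≤ ind (adj G i j)
    pointwise i j with toℕ i <ᵇ toℕ j in i<j | toℕ j <ᵇ toℕ i in j<i
    ... | true  | true  = ⊥-elim (<-asym (<ᵇ⇒< (toℕ i) (toℕ j) (subst T (sym i<j) _))
                                         (<ᵇ⇒< (toℕ j) (toℕ i) (subst T (sym j<i) _)))
    ... | true  | false = ≤-reflexive (+-identityʳ _)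
    ... | false | _     = ind-∧ʳ _ (adj G i j)

module _ {n : ℕ} {G : Graph n} (triangle-free : TriangleFree G) where

  deg-+-deg≤count : {T R : VertexSet n} {a b : Fin n} → adj G a b ≡ true →
    T ∩ adj G a ⊆ R → T ∩ adj G b ⊆ R → deg G T a + deg G T b ≤ count R
  deg-+-deg≤count {T} {a = a} {b} ab = count-disjoint
    (λ i aᵢ bᵢ → triangle-free a b i ab (∧-conicalʳ (T i) _ bᵢ) (∧-conicalʳ (T i) _ aᵢ))

  mantel : (T : VertexSet n) → 2 * arcs G T ≤ count T * count T
  mantel = count-ind _ delete-an-edge
    where
    delete-an-edge : ∀ T → (∀ T′ → count T′ < count T → 2 * arcs G T′ ≤ count T′ * count T′) →
      2 * arcs G T ≤ count T * count T
    delete-an-edge T ih with any? (λ a → any? (λ b → arc G T a b Bool.≟ true))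
    ... | no  no-arc rewrite arcs≡0 G T (λ i j arcᵢⱼ → no-arc (i , j , arcᵢⱼ)) = z≤n
    ... | yes (a , b , arcₐᵦ) with arc-elim G {T} arcₐᵦ
    ...   | Tₐ , Tᵦ , Aₐᵦ = begin
      2 * arcs G T                                      ≤⟨ *-monoʳ-≤ 2 arcs-T ⟩
      2 * (arcs G T₂ + 2 * deg G T₁ b + 2 * deg G T a)  ≡⟨ regroup (arcs G T₂) (deg G T₁ b) (deg G T a) ⟩
      2 * arcs G T₂ + 4 * (deg G T a + deg G T₁ b)      ≤⟨ +-mono-≤ (ih T₂ T₂<T) (*-monoʳ-≤ 4 degrees) ⟩
      count T₂ * count T₂ + 4 * suc (count T₂)          ≡⟨ square (count T₂) ⟩
      suc (suc (count T₂)) * suc (suc (count T₂))       ≡⟨ cong (λ s → s * s) count-T ⟨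
      count T * count T                                 ∎
      where
      open ≤-Reasoning
      T₁ T₂ : VertexSet n
      T₁ = T ∖ ⁅ a ⁆
      T₂ = T₁ ∖ ⁅ b ⁆
      T₁b : T₁ b ≡ true
      T₁b with b ≟ a
      ... | yes refl = ⊥-elim (false≢true (trans (sym (irrefl G b)) Aₐᵦ))
      ... | no  _    = trans (∧-identityʳ (T b)) Tᵦ
      count-T₁ : count T₁ ≡ suc (count T₂)
      count-T₁ = count-∖⁅⁆ T₁ b T₁b
      count-T : count T ≡ suc (suc (count T₂))
      count-T = trans (count-∖⁅⁆ T a Tₐ) (cong suc count-T₁)
      T₂<T : count T₂ < count T
      T₂<T = subst (count T₂ <_) (sym count-T) (m<n⇒m<1+n (n<1+n _))
      arcs-T : arcs G T ≤ arcs G T₂ + 2 * deg G T₁ b + 2 * deg G T a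
      arcs-T = ≤-trans (arcs-∖⁅⁆ G T a) (+-monoˡ-≤ _ (arcs-∖⁅⁆ G T₁ b))
      degrees : deg G T a + deg G T₁ b ≤ suc (count T₂)
      degrees = begin
        deg G T a + deg G T₁ b   ≡⟨ cong (_+ deg G T₁ b) (deg-∖⁅⁆ G T a) ⟨
        deg G T₁ a + deg G T₁ b  ≤⟨ deg-+-deg≤count Aₐᵦ (λ i → ∧-conicalˡ (T₁ i) _) (λ i → ∧-conicalˡ (T₁ i) _) ⟩
        count T₁                 ≡⟨ count-T₁ ⟩
        suc (count T₂)           ∎
      regroup : ∀ e y x → 2 * (e + 2 * y + 2 * x) ≡ 2 * e + 4 * (x + y)
      regroup = solve-∀
      square : ∀ s → s * s + 4 * suc s ≡ suc (suc s) * suc (suc s)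
      square = solve-∀

Reach-snoc : ∀ {n} {G : Graph n} {H : Subgraph G} {X : VertexSet n} {u i j : Fin n} →
  Reach H X u i → es H i j ≡ true → X j ≡ false → Reach H X u j
Reach-snoc here            eᵢⱼ Xⱼ = step eᵢⱼ Xⱼ here
Reach-snoc (step e Xᵥ r)    eᵢⱼ Xⱼ = step e Xᵥ (Reach-snoc r eᵢⱼ Xⱼ)

module _ {n : ℕ} {G : Graph n} {H : Subgraph G} {X : VertexSet n} where

  Reach-end : {u w : Fin n} → Reach H X u w → vs H u ≡ true → X u ≡ false → vs H w ≡ true × X w ≡ false
  Reach-end here               Vᵤ Xᵤ = Vᵤ , Xᵤ
  Reach-end (step {u} eᵤᵥ Xᵥ r) _  _  = Reach-end r (proj₂ (es-vs H u _ eᵤᵥ)) Xᵥ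

  Reach-leaves : {u w : Fin n} → Reach H X u w → (w ≡ u → ⊥) → ∃ λ j → es H u j ≡ true × X j ≡ false
  Reach-leaves here           w≢u = ⊥-elim (w≢u refl)
  Reach-leaves (step e Xⱼ _)  _   = _ , e , Xⱼ

module _ {n : ℕ} {G : Graph n} (H : Subgraph G) (X : VertexSet n) (u : Fin n) where

  ReachableFrom : VertexSet n → Set
  ReachableFrom R = ∀ j → R j ≡ true → Reach H X u j

  ClosedIn : VertexSet n → Set
  ClosedIn R = ∀ i j → R i ≡ true → es H i j ≡ true → X j ≡ false → R j ≡ true

  reach-closure : Σ (VertexSet n) λ R → R u ≡ true × ReachableFrom R × ClosedIn R
  reach-closure = grow n ⁅ u ⁆ (m≤n+m n _) (⁅⁆-self u) start
    where
    start : ReachableFrom ⁅ u ⁆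
    start j _ with j ≟ u
    start j _  | yes refl = here
    start j () | no _

    -- every round adds a vertex to R, so n rounds suffice
    grow : ∀ fuel R → n ≤ count R + fuel → R u ≡ true → ReachableFrom R →
      Σ (VertexSet n) λ R → R u ≡ true × ReachableFrom R × ClosedIn R
    grow fuel R enough Rᵤ reachable
      with any? (λ i → any? (λ j → (R i Bool.≟ true) ×-dec (es H i j Bool.≟ true) ×-dec
                                   (X j Bool.≟ false) ×-dec (R j Bool.≟ false)))
    ... | no no-exit = R , Rᵤ , reachable , closed
      where
      closed : ClosedIn R
      closed i j Rᵢ eᵢⱼ Xⱼ with R j in Rⱼ
      ... | true  = refl
      ... | false = ⊥-elim (no-exit (i , j , Rᵢ , eᵢⱼ , Xⱼ , Rⱼ))
    ... | yes (i , j , Rᵢ , eᵢⱼ , Xⱼ , Rⱼ) = grow′ fuel enough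
      where
      R′ : VertexSet n
      R′ = R ∪ ⁅ j ⁆
      R⊆R′ : R ⊆ R′
      R⊆R′ x Rₓ rewrite Rₓ = refl
      R<R′ : count R < count R′
      R<R′ = count-⊂ R⊆R′ (trans (cong (_∨ ⁅ j ⁆ j) Rⱼ) (⁅⁆-self j)) Rⱼ
      reachable′ : ReachableFrom R′
      reachable′ x R′ₓ with R x in Rₓ | x ≟ j
      reachable′ x _  | true  | _        = reachable x Rₓ
      reachable′ x _  | false | yes refl = Reach-snoc (reachable i Rᵢ) eᵢⱼ Xⱼ
      reachable′ x () | false | no _
      grow′ : ∀ fuel → n ≤ count R + fuel → Σ (VertexSet n) λ R → R u ≡ true × ReachableFrom R × ClosedIn R
      grow′ zero       enough = ⊥-elim (<-irrefl refl (≤-trans R<R′ (≤-trans (count≤n R′)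
                                  (subst (n ≤_) (+-identityʳ _) enough))))
      grow′ (suc fuel) enough = grow fuel R′ (≤-trans enough (≤-trans (≤-reflexive (+-suc _ fuel))
                                  (+-monoˡ-≤ fuel R<R′))) (R⊆R′ u Rᵤ) reachable′

module _ {n : ℕ} {G : Graph n} (triangle-free : TriangleFree G) {k : ℕ} {H : Subgraph G}
         (connected : IsConnected (k + 1) H) where

  connected-min-deg : {u : Fin n} → vs H u ≡ true → k < count (es H u)
  connected-min-deg {u} Vᵤ with count (es H u) ≤? k
  ... | no  high = ≰⇒> high
  ... | yes low  with count<⇒∃∉ {p = es H u ∪ ⁅ u ⁆} {vs H} fewer
    where
    fewer : count (es H u ∪ ⁅ u ⁆) < count (vs H)
    fewer = begin-strict
      count (es H u ∪ ⁅ u ⁆)       ≤⟨ count-∪-≤ (es H u) ⁅ u ⁆ ⟩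
      count (es H u) + count ⁅ u ⁆  ≤⟨ +-mono-≤ low (≤-reflexive (count-⁅⁆ u)) ⟩
      k + 1                        <⟨ proj₁ connected ⟩
      count (vs H)                 ∎
      where open ≤-Reasoning
  ...   | w , V_w , w∉ = ⊥-elim (false≢true (trans (sym Xⱼ) eᵤⱼ))
    where
    X : VertexSet n
    X = es H u
    Xᵤ : X u ≡ false
    Xᵤ with X u in eᵤᵤ
    ... | false = refl
    ... | true  = ⊥-elim (false≢true (trans (sym (irrefl G u)) (es-sub H u u eᵤᵤ)))
    w≢u : w ≡ u → ⊥
    w≢u refl = false≢true (trans (sym (∨-conicalʳ (X w) _ w∉)) (⁅⁆-self u))
    walk : Reach H X u w
    walk = proj₂ connected X (λ i → proj₂ ∘ es-vs H u i) (subst (suc (count X) ≤_) (+-comm 1 k) (s≤s low))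
             u w Vᵤ Xᵤ V_w (∨-conicalˡ (X w) _ w∉)
    j : Fin n
    j = proj₁ (Reach-leaves walk w≢u)
    eᵤⱼ : X j ≡ true
    eᵤⱼ = proj₁ (proj₂ (Reach-leaves walk w≢u))
    Xⱼ : X j ≡ false
    Xⱼ = proj₂ (proj₂ (Reach-leaves walk w≢u))

  connected-size : 2 * (k + 1) ≤ vH H
  connected-size with count>0⇒∃ {p = vs H} (≤-trans (s≤s z≤n) (proj₁ connected))
  ... | u , Vᵤ with count>0⇒∃ {p = es H u} (≤-trans (s≤s z≤n) (connected-min-deg Vᵤ))
  ...   | b , eᵤᵦ = begin
    2 * (k + 1)                      ≡⟨ cong (λ m → m + (m + 0)) (+-comm k 1) ⟩
    suc k + (suc k + 0)              ≡⟨ cong (suc k +_) (+-identityʳ (suc k)) ⟩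
    suc k + suc k                    ≤⟨ +-mono-≤ (connected-min-deg Vᵤ) (connected-min-deg Vᵦ) ⟩
    count (es H u) + count (es H b)  ≤⟨ count-disjoint disjoint (λ i → proj₂ ∘ es-vs H u i) (λ i → proj₂ ∘ es-vs H b i) ⟩
    count (vs H)                     ∎
    where
    open ≤-Reasoning
    Vᵦ : vs H b ≡ true
    Vᵦ = proj₂ (es-vs H u b eᵤᵦ)
    disjoint : ∀ i → es H u i ≡ true → es H b i ≡ true → ⊥
    disjoint i eᵤᵢ eᵦᵢ = triangle-free u b i (es-sub H u b eᵤᵦ) (es-sub H b i eᵦᵢ) (es-sub H u i eᵤᵢ)

module Mader {n : ℕ} (G : Graph n) (triangle-free : TriangleFree G) (k : ℕ) where

  -- e(G[S]) > k(|S| − k), as arcs counts every edge of G[S] twice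
  Heavy : VertexSet n → Set
  Heavy S = 2 * k * count S < arcs G S + 2 * k * k

  Dense : VertexSet n → Set
  Dense S = 2 * k + 2 ≤ count S × Heavy S

  dense? : (S : VertexSet n) → Dec (Dense S)
  dense? S = (2 * k + 2 ≤? count S) ×-dec (2 * k * count S <? arcs G S + 2 * k * k)

  dense-resp : {S T : VertexSet n} → (∀ i → S i ≡ T i) → Dense S → Dense T
  dense-resp S≗T (large , heavy) =
    subst (2 * k + 2 ≤_) (count-cong S≗T) large ,
    subst₂ (λ c a → 2 * k * c < a + 2 * k * k) (count-cong S≗T) (arcs-cong G S≗T) heavy

  heavy-∖⁅⁆ : {S : VertexSet n} {u : Fin n} → S u ≡ true → deg G S u ≤ k → Heavy S → Heavy (S ∖ ⁅ u ⁆)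
  heavy-∖⁅⁆ {S} {u} Sᵤ low heavy = +-cancelʳ-< (2 * k) _ _ (begin-strict
    2 * k * count S′ + 2 * k               ≡⟨ *-suc-distrib (count S′) ⟩
    2 * k * suc (count S′)                 ≡⟨ cong (2 * k *_) (count-∖⁅⁆ S u Sᵤ) ⟨
    2 * k * count S                        <⟨ heavy ⟩
    arcs G S + 2 * k * k                   ≤⟨ +-monoˡ-≤ (2 * k * k) (arcs-∖⁅⁆ G S u) ⟩
    arcs G S′ + 2 * deg G S u + 2 * k * k  ≤⟨ +-monoˡ-≤ (2 * k * k) (+-monoʳ-≤ (arcs G S′) (*-monoʳ-≤ 2 low)) ⟩
    arcs G S′ + 2 * k + 2 * k * k          ≡⟨ swap (arcs G S′) ⟩
    arcs G S′ + 2 * k * k + 2 * k          ∎)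
    where
    open ≤-Reasoning
    S′ : VertexSet n
    S′ = S ∖ ⁅ u ⁆
    *-suc-distrib : ∀ s → 2 * k * s + 2 * k ≡ 2 * k * suc s
    *-suc-distrib s = trans (+-comm _ (2 * k)) (sym (*-suc (2 * k) s))
    swap : ∀ a → a + 2 * k + 2 * k * k ≡ a + 2 * k * k + 2 * k
    swap a = trans (+-assoc a _ _) (trans (cong (a +_) (+-comm (2 * k) _)) (sym (+-assoc a _ _)))

  ¬heavy-2k+1 : {T : VertexSet n} → count T ≡ 2 * k + 1 → ¬ Heavy T
  ¬heavy-2k+1 {T} size heavy = <-irrefl refl (begin-strict
    (2 * k + 1) * (2 * k + 1) + 4 * k * k        <⟨ n<1+n _ ⟩
    suc ((2 * k + 1) * (2 * k + 1) + 4 * k * k)  ≡⟨ double k ⟩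
    2 * suc (2 * k * (2 * k + 1))                ≤⟨ *-monoʳ-≤ 2 heavy′ ⟩
    2 * (arcs G T + 2 * k * k)                   ≡⟨ *-distribˡ-+ 2 (arcs G T) _ ⟩
    2 * arcs G T + 2 * (2 * k * k)               ≤⟨ +-monoˡ-≤ (2 * (2 * k * k)) mantel′ ⟩
    (2 * k + 1) * (2 * k + 1) + 2 * (2 * k * k)  ≡⟨ cong ((2 * k + 1) * (2 * k + 1) +_) (four k) ⟩
    (2 * k + 1) * (2 * k + 1) + 4 * k * k        ∎)
    where
    open ≤-Reasoning
    heavy′ : suc (2 * k * (2 * k + 1)) ≤ arcs G T + 2 * k * k
    heavy′ = subst (λ s → suc (2 * k * s) ≤ arcs G T + 2 * k * k) size heavy
    mantel′ : 2 * arcs G T ≤ (2 * k + 1) * (2 * k + 1)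
    mantel′ = subst (λ s → 2 * arcs G T ≤ s * s) size (mantel {G = G} triangle-free T)
    double : ∀ k → suc ((2 * k + 1) * (2 * k + 1) + 4 * k * k) ≡ 2 * suc (2 * k * (2 * k + 1))
    double = solve-∀
    four : ∀ k → 2 * (2 * k * k) ≡ 4 * k * k
    four = solve-∀

  ¬heavy-split : {S S₁ S₂ X : VertexSet n} → arcs G S ≤ arcs G S₁ + arcs G S₂ →
    count S₁ + count S₂ ≡ count S + count X → count X ≤ k → ¬ Heavy S₁ → ¬ Heavy S₂ → ¬ Heavy S
  ¬heavy-split {S} {S₁} {S₂} {X} cover sizes small light₁ light₂ heavy = <-irrefl refl (begin-strict
    2 * k * count S + 2 * k * k                        <⟨ +-monoˡ-< (2 * k * k) heavy ⟩
    arcs G S + 2 * k * k + 2 * k * k                   ≤⟨ +-monoˡ-≤ (2 * k * k) (+-monoˡ-≤ (2 * k * k) cover) ⟩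
    arcs G S₁ + arcs G S₂ + 2 * k * k + 2 * k * k      ≡⟨ regroup (arcs G S₁) (arcs G S₂) (2 * k * k) ⟩
    (arcs G S₁ + 2 * k * k) + (arcs G S₂ + 2 * k * k)  ≤⟨ +-mono-≤ (≮⇒≥ light₁) (≮⇒≥ light₂) ⟩
    2 * k * count S₁ + 2 * k * count S₂                ≡⟨ *-distribˡ-+ (2 * k) (count S₁) (count S₂) ⟨
    2 * k * (count S₁ + count S₂)                      ≡⟨ cong (2 * k *_) sizes ⟩
    2 * k * (count S + count X)                        ≡⟨ *-distribˡ-+ (2 * k) (count S) (count X) ⟩
    2 * k * count S + 2 * k * count X                  ≤⟨ +-monoʳ-≤ (2 * k * count S) (*-monoʳ-≤ (2 * k) small) ⟩
    2 * k * count S + 2 * k * k                        ∎)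
    where
    open ≤-Reasoning
    regroup : ∀ a b c → a + b + c + c ≡ (a + c) + (b + c)
    regroup = solve-∀

  dense-full : 1 ≤ k → 1 ≤ n → 2 * k * n ≤ 2 * e G → Dense full
  dense-full k≥1 n≥1 average = subst (2 * k + 2 ≤_) (sym (count-full {n})) large ,
                               subst (λ s → 2 * k * s < arcs G full + 2 * k * k) (sym (count-full {n})) heavy
    where
    many-arcs : 2 * k * n ≤ arcs G full
    many-arcs = ≤-trans average (2e≤arcs G)
    heavy : 2 * k * n < arcs G full + 2 * k * k
    heavy = begin-strict
      2 * k * n                  ≡⟨ +-identityʳ _ ⟨
      2 * k * n + 0              <⟨ +-monoʳ-< (2 * k * n) (*-mono-≤ (≤-trans k≥1 (m≤m+n k (k + 0))) k≥1) ⟩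
      2 * k * n + 2 * k * k      ≤⟨ +-monoˡ-≤ (2 * k * k) many-arcs ⟩
      arcs G full + 2 * k * k    ∎
      where open ≤-Reasoning
    large : 2 * k + 2 ≤ n
    large = begin
      2 * k + 2      ≤⟨ +-monoʳ-≤ (2 * k) (*-monoʳ-≤ 2 k≥1) ⟩
      2 * k + 2 * k  ≡⟨ double k ⟩
      4 * k          ≤⟨ *-cancelʳ-≤ (4 * k) n n {{>-nonZero n≥1}} 4kn≤n² ⟩
      n              ∎
      where
      open ≤-Reasoning
      double : ∀ k → 2 * k + 2 * k ≡ 4 * k
      double = solve-∀
      quadruple : ∀ k n → 4 * k * n ≡ 2 * (2 * k * n)
      quadruple = solve-∀
      4kn≤n² : 4 * k * n ≤ n * n
      4kn≤n² = begin
        4 * k * n              ≡⟨ quadruple k n ⟩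
        2 * (2 * k * n)        ≤⟨ *-monoʳ-≤ 2 many-arcs ⟩
        2 * arcs G full        ≤⟨ mantel {G = G} triangle-free full ⟩
        count (full {n}) * count (full {n})  ≡⟨ cong (λ s → s * s) (count-full {n}) ⟩
        n * n                  ∎

  module Minimal {S : VertexSet n} (dense : Dense S) (minimal : ∀ T → count T < count S → ¬ Dense T) where

    no-low-degree : {u : Fin n} → S u ≡ true → deg G S u ≤ k → ⊥
    no-low-degree {u} Sᵤ low with 2 * k + 2 ≤? count (S ∖ ⁅ u ⁆)
    ... | yes large = minimal (S ∖ ⁅ u ⁆) S′<S (large , heavy′)
      where
      S′<S : count (S ∖ ⁅ u ⁆) < count S
      S′<S = ≤-reflexive (sym (count-∖⁅⁆ S u Sᵤ))
      heavy′ : Heavy (S ∖ ⁅ u ⁆)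
      heavy′ = heavy-∖⁅⁆ Sᵤ low (proj₂ dense)
    ... | no  small = ¬heavy-2k+1 size (heavy-∖⁅⁆ Sᵤ low (proj₂ dense))
      where
      size : count (S ∖ ⁅ u ⁆) ≡ 2 * k + 1
      size = ≤-antisym (≤-pred (subst (count (S ∖ ⁅ u ⁆) <_) (+-suc (2 * k) 1) (≰⇒> small)))
                       (≤-pred (subst₂ _≤_ (+-suc (2 * k) 1) (count-∖⁅⁆ S u Sᵤ) (proj₁ dense)))

    min-deg : {u : Fin n} → S u ≡ true → k < deg G S u
    min-deg {u} Sᵤ with deg G S u ≤? k
    ... | yes low  = ⊥-elim (no-low-degree Sᵤ low)
    ... | no  high = ≰⇒> high

    Closed : VertexSet n → VertexSet n → Set
    Closed X T = ∀ c j → T c ≡ true → X c ≡ false → S j ≡ true → adj G c j ≡ true → T j ≡ true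

    closed-large : {X T : VertexSet n} {a : Fin n} → count X ≤ k → Closed X T →
      T a ≡ true → S a ≡ true → X a ≡ false → 2 * k + 2 ≤ count T
    closed-large {X} {T} {a} small closed Tₐ Sₐ Xₐ
      with count<⇒∃∉ {p = X} {S ∩ adj G a} (≤-<-trans small (min-deg Sₐ))
    ... | b , Nᵦ , Xᵦ = begin
      2 * k + 2              ≡⟨ halves k ⟩
      suc k + suc k          ≤⟨ +-mono-≤ (min-deg Sₐ) (min-deg Sᵦ) ⟩
      deg G S a + deg G S b  ≤⟨ deg-+-deg≤count {G = G} triangle-free Aₐᵦ (N⊆T Tₐ Xₐ) (N⊆T Tᵦ Xᵦ) ⟩
      count T                ∎
      where
      open ≤-Reasoning
      Sᵦ : S b ≡ true
      Sᵦ = ∧-conicalˡ (S b) _ Nᵦ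
      Aₐᵦ : adj G a b ≡ true
      Aₐᵦ = ∧-conicalʳ (S b) _ Nᵦ
      Tᵦ : T b ≡ true
      Tᵦ = closed a b Tₐ Xₐ Sᵦ Aₐᵦ
      N⊆T : ∀ {c} → T c ≡ true → X c ≡ false → S ∩ adj G c ⊆ T
      N⊆T {c} T_c X_c j Nⱼ = closed c j T_c X_c (∧-conicalˡ (S j) _ Nⱼ) (∧-conicalʳ (S j) _ Nⱼ)
      halves : ∀ k → 2 * k + 2 ≡ suc k + suc k
      halves = solve-∀

    module Sides {X R : VertexSet n} (R⊆S : R ⊆ S)
      (R-closed : ∀ {i j} → R i ≡ true → S j ≡ true → adj G i j ≡ true → X j ≡ false → R j ≡ true) where

      S₁ S₂ : VertexSet n
      S₁ = R ∪ X
      S₂ = S ∖ R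

      S₁-closed : Closed X S₁
      S₁-closed c j S₁c X_c Sⱼ A_cj with R c in R_c
      ... | false = ⊥-elim (false≢true (trans (sym X_c) S₁c))
      ... | true with X j in Xⱼ
      ...   | true  = ∨-zeroʳ (R j)
      ...   | false rewrite R-closed R_c Sⱼ A_cj Xⱼ = refl

      S₂-closed : Closed X S₂
      S₂-closed c j S₂c X_c Sⱼ A_cj with R j in Rⱼ
      ... | false rewrite Sⱼ = refl
      ... | true  = ⊥-elim (false≢true (trans (sym (cong not R_c)) (∧-conicalʳ (S c) _ S₂c)))
        where
        R_c : R c ≡ true
        R_c = R-closed Rⱼ (∧-conicalˡ (S c) _ S₂c) (trans (adj-sym G j c) A_cj) X_c

      sides-cover : ∀ i j → arc G S i j ≡ true → arc G S₁ i j ≡ true ⊎ arc G S₂ i j ≡ true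
      sides-cover i j arcᵢⱼ with arc-elim G {S} arcᵢⱼ | R i in Rᵢ | R j in Rⱼ
      ... | _ , _ , Aᵢⱼ | true | true = inj₁ Aᵢⱼ
      ... | _ , Sⱼ , Aᵢⱼ | true | false with X j in Xⱼ
      ...   | true  = inj₁ Aᵢⱼ
      ...   | false = ⊥-elim (false≢true (trans (sym Rⱼ) (R-closed Rᵢ Sⱼ Aᵢⱼ Xⱼ)))
      sides-cover i j arcᵢⱼ | Sᵢ , _ , Aᵢⱼ | false | true with X i in Xᵢ
      ...   | true  = inj₁ Aᵢⱼ
      ...   | false = ⊥-elim (false≢true (trans (sym Rᵢ) (R-closed Rⱼ Sᵢ (trans (adj-sym G j i) Aᵢⱼ) Xᵢ)))
      sides-cover i j arcᵢⱼ | Sᵢ , Sⱼ , Aᵢⱼ | false | false rewrite Sᵢ | Sⱼ = inj₂ Aᵢⱼ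

    closed-¬heavy : {X T : VertexSet n} {x y : Fin n} → count X ≤ k → T ⊆ S → S x ≡ true → T x ≡ false →
      Closed X T → T y ≡ true → X y ≡ false → ¬ Heavy T
    closed-¬heavy {y = y} small T⊆S Sₓ Tₓ closed T_y X_y heavy =
      minimal _ (count-⊂ T⊆S Sₓ Tₓ) (closed-large small closed T_y (T⊆S y T_y) X_y , heavy)

    no-separator : {X R : VertexSet n} {u w : Fin n} → X ⊆ S → count X ≤ k →
      S u ≡ true → X u ≡ false → S w ≡ true → X w ≡ false →
      R u ≡ true → ReachableFrom (induced G S) X u R → ClosedIn (induced G S) X u R → R w ≡ false → ⊥
    no-separator {X} {R} {u} {w} X⊆S small Sᵤ Xᵤ S_w X_w Rᵤ reachable closed R_w =
      ¬heavy-split (arcs-cover G {S} {S₁} {S₂} sides-cover) (count-∪-∖ R⊆S R∩X≡∅) small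
        (closed-¬heavy small S₁⊆S S_w S₁w S₁-closed S₁u Xᵤ)
        (closed-¬heavy small S₂⊆S Sᵤ S₂u S₂-closed S₂w X_w)
        (proj₂ dense)
      where
      R⊆S : R ⊆ S
      R⊆S j Rⱼ = proj₁ (Reach-end (reachable j Rⱼ) Sᵤ Xᵤ)
      R∩X≡∅ : ∀ j → R j ≡ true → X j ≡ true → ⊥
      R∩X≡∅ j Rⱼ Xⱼ = false≢true (trans (sym (proj₂ (Reach-end (reachable j Rⱼ) Sᵤ Xᵤ))) Xⱼ)
      open Sides R⊆S (λ {i} {j} Rᵢ Sⱼ Aᵢⱼ → closed i j Rᵢ (arc-intro G {S} (R⊆S i Rᵢ) Sⱼ Aᵢⱼ))
      S₁⊆S : S₁ ⊆ S
      S₁⊆S i _   with R i in Rᵢ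
      S₁⊆S i _   | true  = R⊆S i Rᵢ
      S₁⊆S i Xᵢ  | false = X⊆S i Xᵢ
      S₂⊆S : S₂ ⊆ S
      S₂⊆S i = ∧-conicalˡ (S i) _
      S₁u : S₁ u ≡ true
      S₁u rewrite Rᵤ = refl
      S₁w : S₁ w ≡ false
      S₁w rewrite R_w | X_w = refl
      S₂u : S₂ u ≡ false
      S₂u rewrite Rᵤ = ∧-zeroʳ (S u)
      S₂w : S₂ w ≡ true
      S₂w rewrite S_w | R_w = refl

    minimal-connected : IsConnected (k + 1) (induced G S)
    minimal-connected = k+1<|S| , separated
      where
      k+1<|S| : k + 1 < count S
      k+1<|S| = ≤-trans (≤-reflexive (sym (+-suc k 1))) (≤-trans (+-monoˡ-≤ 2 (m≤m+n k (k + 0))) (proj₁ dense))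
      separated : ∀ X → X ⊆ S → suc (count X) ≤ k + 1 → ConnectedMinus (induced G S) X
      separated X X⊆S bound u w Sᵤ Xᵤ S_w X_w with reach-closure (induced G S) X u
      ... | R , Rᵤ , reachable , closed with R w in R_w
      ...   | true  = reachable w R_w
      ...   | false = ⊥-elim (no-separator X⊆S small Sᵤ Xᵤ S_w X_w Rᵤ reachable closed R_w)
        where
        small : count X ≤ k
        small = ≤-pred (subst (suc (count X) ≤_) (+-comm k 1) bound)

theorem3 : (k : ℕ) → 1 ≤ k → (n : ℕ) → (G : Graph n) → 1 ≤ v G →
    TriangleFree G → 2 * k * v G ≤ 2 * e G →
    Σ (Subgraph G) (λ H → IsConnected (k + 1) H)
      × ((H : Subgraph G) → IsConnected (k + 1) H → 2 * (k + 1) ≤ vH H)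
theorem3 k k≥1 n G n≥1 triangle-free average =
  (induced G S , minimal-connected) , λ _ → connected-size triangle-free
  where
  open Mader G triangle-free k
  smallest : Σ (VertexSet n) λ S → Dense S × (∀ T → count T < count S → ¬ Dense T)
  smallest = smallest-witness Dense dense? dense-resp (dense-full k≥1 n≥1 average)
  S : VertexSet n
  S = proj₁ smallest
  open Minimal (proj₁ (proj₂ smallest)) (proj₂ (proj₂ smallest))
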